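{- Let $(N,*)$ be a rectangular groupoid. Define $R=\{(a,a*b): a,b\in N\}$ and $G=\{(a*b,b): a,b\in N\}$. Then the graph pair $(N,R),(N,G)$ has property $P_2$.
   Context: A groupoid $(A,*)$ is a rectangular groupoid if for all $a,b,c,d,x\in A$: $a*b=c*d=x$ implies $a*d=c*b=x$. Graphs are directed graphs on node set $N$ with edge sets subsets of $N\times N$ (loops allowed). A pair of graphs $(N,R),(N,G)$ has property $P_2$ if for every $a,b\in N$ there exists a unique $c\in N$ with $(a,c)\in R$ and $(c,b)\in G$. -}

module Defs where

open import Data.Product using (∃; ∃-syntax; ∃!; _×_; _,_)
open import Relation.Binary.PropositionalEquality using (_≡_)

Graph : Set → Set₁
Graph N = N → N → Set

IsRectangular : {N : Set} → (N → N → N) → Set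
IsRectangular {N} _*_ =
  ∀ (a b c d x : N) → a * b ≡ x → c * d ≡ x → (a * d ≡ x × c * b ≡ x)

P₂ : {N : Set} → Graph N → Graph N → Set
P₂ {N} R G = ∀ (a b : N) → ∃! _≡_ (λ c → R a c × G c b)

Rgraph : {N : Set} → (N → N → N) → Graph N
Rgraph _*_ a c = ∃[ b ] c ≡ a * b

Ggraph : {N : Set} → (N → N → N) → Graph N
Ggraph _*_ c b = ∃[ a ] c ≡ a * b

module Submission where

-- For a rectangular groupoid (N,*) the unique node between a and b in
-- the graph pair R = {(a, a*b)}, G = {(a*b, b)} is a*b itself.
--
--   * Existence: (a, a*b) ∈ R via b, and (a*b, b) ∈ G via a.
--   * Uniqueness: if (a, c) ∈ R and (c, b) ∈ G then c = a*y and
--     c = x*b for some x, y; rectangularity applied to a*y = x*b = c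
--     yields a*b = c.

open import Defs
open import Data.Product using (∃!; _×_; _,_; proj₁)
open import Relation.Binary.PropositionalEquality using (_≡_; refl; sym)

module _ {N : Set} (_*_ : N → N → N) where

  product-is-midpoint : ∀ (a b : N) → Rgraph _*_ a (a * b) × Ggraph _*_ (a * b) b
  product-is-midpoint a b = (b , refl) , (a , refl)

  midpoint-is-product : IsRectangular _*_ →
    ∀ {a b c : N} → Rgraph _*_ a c × Ggraph _*_ c b → a * b ≡ c
  midpoint-is-product rect {a} {b} {c} ((y , c≡a*y) , (x , c≡x*b)) =
    proj₁ (rect a y x b c (sym c≡a*y) (sym c≡x*b))

mainTheorem3 : (N : Set) (_*_ : N → N → N) → IsRectangular _*_ → P₂ (Rgraph _*_) (Ggraph _*_)
mainTheorem3 N _*_ rect a b =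
  a * b , product-is-midpoint _*_ a b , midpoint-is-product _*_ rect
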